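{- If an Elena of size $n$ is chosen uniformly at random, the expected number $k$ of nodes on its rightmost branch $v_1,\dots,v_k$ is asymptotic to $\frac{5-\sqrt5}{10}\,n$ as $n\to\infty$; consequently the expected number of nodes lying in attached paths is asymptotic to $\frac{5+\sqrt5}{10}\,n$.
   Context: Planted plane trees are rooted trees in which the children of every node are linearly ordered. An Elena is a planted plane tree of the following form: there are nodes $v_1,\dots,v_k$ ($k\ge 1$), with $v_1$ the root, such that for each $i<k$ the node $v_{i+1}$ is the rightmost child of $v_i$, the node $v_k$ is a leaf, and for each $i<k$ every other child of $v_i$ (any number $\ge0$ of them, placed to the left of $v_{i+1}$) is the top node of a path (a chain of $\ge1$ nodes each having at most one child); these chains are the attached paths, and $v_1,\dots,v_k$ form the rightmost branch. Equivalently, Elenas correspond to words of the language $(\mathtt{a}\,\mathtt{p}^*)^*\mathtt{a}$, with $\mathtt{a}$ a rightmost-branch node and $\mathtt{p}$ an attached path. The size of an Elena is its number of nodes. -}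

module Defs where

open import Data.Nat using (ℕ; zero; suc; _+_; _∸_; _≥_)
open import Data.List using (List; []; _∷_; _∷ʳ_; length; map)
open import Data.Nat.ListAction using (sum)
open import Data.List.Relation.Unary.All using (All)
open import Data.Integer using (+_)
open import Data.Rational using (ℚ; _/_; _*_; _-_; _<_; _≤_; 0ℚ)
open import Data.Product using (_×_; ∃-syntax)
open import Data.Sum using (_⊎_)

-- Planted plane trees: a node with an ordered (left-to-right) list of children.
data PTree : Set where
  node : List PTree → PTree

mutual
  size : PTree → ℕ
  size (node ts) = suc (sizes ts)

  sizes : List PTree → ℕ
  sizes [] = 0
  sizes (t ∷ ts) = size t + sizes ts

data IsPath : PTree → Set where
  end  : IsPath (node [])
  cons : ∀ {t} → IsPath t → IsPath (node (t ∷ []))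

data IsElena : PTree → Set where
  leaf : IsElena (node [])
  step : ∀ {cs r} → All IsPath cs → IsElena r → IsElena (node (cs ∷ʳ r))

-- Number of nodes on the rightmost branch v₁,…,v_k (follow rightmost children to a leaf).
mutual
  rightBranch : PTree → ℕ
  rightBranch (node ts) = suc (rightBranchL ts)

  rightBranchL : List PTree → ℕ
  rightBranchL [] = 0
  rightBranchL (t ∷ []) = rightBranch t
  rightBranchL (t ∷ u ∷ ts) = rightBranchL (u ∷ ts)

-- Number of nodes lying in attached paths (every node of an Elena is either on
-- the rightmost branch or in an attached path).
attachedNodes : PTree → ℕ
attachedNodes t = size t ∸ rightBranch t

ℕtoℚ : ℕ → ℚ
ℕtoℚ n = (+ n) / 1

-- Comparisons with the irrational constants c₋ = (5 - √5)/10 and c₊ = (5 + √5)/10,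
-- expressed exactly over ℚ (no reals in the library):
--   q < c₋  ⇔  √5 < 5 - 10q  ⇔  0 ≤ 5 - 10q ∧ 5 < (5 - 10q)²
--   q > c₋  ⇔  √5 > 5 - 10q  ⇔  5 - 10q < 0 ∨ (5 - 10q)² < 5
--   q < c₊  ⇔  10q - 5 < √5  ⇔  10q - 5 < 0 ∨ (10q - 5)² < 5
--   q > c₊  ⇔  10q - 5 > √5  ⇔  0 ≤ 10q - 5 ∧ 5 < (10q - 5)²
five ten : ℚ
five = ℕtoℚ 5
ten = ℕtoℚ 10

BelowC₋ AboveC₋ BelowC₊ AboveC₊ : ℚ → Set
BelowC₋ q = (0ℚ ≤ five - ten * q) × (five < (five - ten * q) * (five - ten * q))
AboveC₋ q = (five - ten * q < 0ℚ) ⊎ ((five - ten * q) * (five - ten * q) < five)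
BelowC₊ q = (ten * q - five < 0ℚ) ⊎ ((ten * q - five) * (ten * q - five) < five)
AboveC₊ q = (0ℚ ≤ ten * q - five) × (five < (ten * q - five) * (ten * q - five))

-- Expected value of f over a uniform choice from the list L (as a rational,
-- with the division cleared): expectation E = sum f / length L.
-- "x_n / n → c" for x_n = (Σ f)/|L_n| is stated as: for all rationals a < c < b,
-- eventually a · n · |L_n| < Σ f < b · n · |L_n|.
sumℚ : (PTree → ℕ) → List PTree → ℚ
sumℚ f L = ℕtoℚ (sum (map f L))

AsymptoticTo : (Below Above : ℚ → Set) → (ℕ → List PTree) → (PTree → ℕ) → Set
AsymptoticTo Below Above L f =
  ∀ (a b : ℚ) → Below a → Above b →
    ∃[ N ] ∀ n → n ≥ N →
      (a * ℕtoℚ n * ℕtoℚ (length (L n)) < sumℚ f (L n)) ×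
      (sumℚ f (L n) < b * ℕtoℚ n * ℕtoℚ (length (L n)))

module Submission where

open import Defs
open import Data.Nat using (ℕ)
open import Data.List using (List)
open import Data.List.Membership.Propositional using (_∈_)
open import Data.List.Relation.Unary.Unique.Propositional using (Unique)
open import Data.Product using (_×_)
open import Function.Bundles using (_⇔_)
open import Relation.Binary.PropositionalEquality using (_≡_)
open import Data.Product using (_,_)

-- An explicit duplicate-free list `elenas n` of all Elenas of size n: a non-leaf
--    Elena either has one child below the root (`wrap` of an Elena of size n - 1), or its leftmost
--    attached path is a single node (`addLeaf` of a non-leaf Elena of size n - 1), or that path is
--    longer (`grow` of a smaller Elena of the same kind).  Any list L n as in the theorem is a
--    permutation of `elenas n`, so counts and sums over L n are computed on `elenas n`.
-- 2. Counting.  This decomposition gives linear recurrences for the numbers u, v of Elenas of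
--    size m + 2 with one resp. several children of the root (Fibonacci numbers) and for the total
--    length r of their rightmost branches.  With x = u + v (the count) and h = u + 3v we derive
--    the Pell equation h² + 4 = 5x² from Cassini's identity and the closed form
--    10r = n(5x - h) + 8x + 4h, where n = m + 2; all of this is natural-number algebra.
-- 3. Analysis over ℚ (a "profile" is any (n, x, h, r) satisfying these relations).  Since
--    h/x → √5, r/(nx) → (5 - √5)/10; without real numbers, the comparisons with √5 are done by
--    comparing squares, and the upper bound uses the Archimedean property of ℚ.
-- 4. The attached nodes of a tree are the complement of its rightmost branch, which turns the
--    first asymptotic statement into the second one under q ↦ 1 - q.

module Enumeration where

  open import Data.Nat as ℕ using (zero; suc)
  import Data.Nat.Properties as ℕP
  open import Data.List using ([]; _∷_; _∷ʳ_; _++_; map)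
  open import Data.List.Relation.Unary.All using (All; []; _∷_)
  open import Data.List.Relation.Unary.Any using (here)
  open import Data.List.Relation.Unary.AllPairs using ([]; _∷_)
  open import Data.List.Membership.Propositional.Properties using (∈-map⁻; ∈-map⁺; ∈-++⁻; ∈-++⁺ˡ; ∈-++⁺ʳ)
  import Data.List.Relation.Unary.Unique.Propositional.Properties as Unique
  open import Data.List.Relation.Binary.Disjoint.Propositional using (Disjoint)
  open import Data.Product using (_,_; proj₁; map₁; ∃-syntax)
  open import Data.Sum using (inj₁; inj₂)
  open import Data.Empty using (⊥)
  open import Function.Bundles using (mk⇔)
  open import Relation.Binary.PropositionalEquality
  open import Relation.Nullary using (¬_)

  children : PTree → List PTree
  children (node ts) = ts

  leafTree : PTree
  leafTree = node []

  -- The children of the root of an Elena with at least two nodes: attached paths, then an Elena.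
  data Spine : List PTree → Set where
    last : ∀ {r} → IsElena r → Spine (r ∷ [])
    path : ∀ {p ts} → IsPath p → Spine ts → Spine (p ∷ ts)

  spine : ∀ {cs r} → All IsPath cs → IsElena r → Spine (cs ∷ʳ r)
  spine []        e = last e
  spine (pp ∷ ps) e = path pp (spine ps e)

  data SpineView : List PTree → Set where
    split : ∀ {cs r} → All IsPath cs → IsElena r → SpineView (cs ∷ʳ r)

  spine-view : ∀ {ts} → Spine ts → SpineView ts
  spine-view (last e) = split [] e
  spine-view (path pp sp) with spine-view sp
  ... | split ps e = split (pp ∷ ps) e

  spine⇒elena : ∀ {t} → Spine (children t) → IsElena t
  spine⇒elena {node ts} sp with spine-view sp
  ... | split ps e = step ps e

  Branching : PTree → Set
  Branching (node [])       = ⊥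
  Branching (node (p ∷ ts)) = IsPath p × Spine ts

  branching⇒spine : ∀ {t} → Branching t → Spine (children t)
  branching⇒spine {node (p ∷ ts)} (pp , sp) = path pp sp

  wrap addLeaf grow : PTree → PTree
  wrap t = node (t ∷ [])
  addLeaf (node ts) = node (leafTree ∷ ts)
  grow (node [])       = node []
  grow (node (p ∷ ts)) = node (wrap p ∷ ts)

  size-wrap : ∀ t → size (wrap t) ≡ suc (size t)
  size-wrap t = cong suc (ℕP.+-identityʳ (size t))

  size-grow : ∀ p ts → size (grow (node (p ∷ ts))) ≡ suc (size (node (p ∷ ts)))
  size-grow p ts = cong (λ k → suc (suc (k ℕ.+ sizes ts))) (ℕP.+-identityʳ (size p))

  leaves : ℕ → List PTree
  leaves 1 = leafTree ∷ []
  leaves _ = []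

  mutual
    elenas : ℕ → List PTree
    elenas n = leaves n ++ nonLeaf n

    nonLeaf : ℕ → List PTree
    nonLeaf n = unary n ++ branching n

    unary : ℕ → List PTree
    unary zero    = []
    unary (suc n) = map wrap (elenas n)

    branching : ℕ → List PTree
    branching zero    = []
    branching (suc n) = map addLeaf (nonLeaf n) ++ map grow (branching n)

  wrap-spine : ∀ {t n} → IsElena t × size t ≡ n → Spine (children (wrap t)) × size (wrap t) ≡ suc n
  wrap-spine {t} (e , sz) = last e , trans (size-wrap t) (cong suc sz)

  addLeaf-branching : ∀ {t n} → Spine (children t) × size t ≡ n →
                      Branching (addLeaf t) × size (addLeaf t) ≡ suc n
  addLeaf-branching {node ts} (sp , sz) = (end , sp) , cong suc sz

  grow-branching : ∀ {t n} → Branching t × size t ≡ n → Branching (grow t) × size (grow t) ≡ suc n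
  grow-branching {node (p ∷ ts)} ((pp , sp) , sz) = (cons pp , sp) , trans (size-grow p ts) (cong suc sz)

  mutual
    elenas-sound : ∀ n {t} → t ∈ elenas n → IsElena t × size t ≡ n
    elenas-sound n t∈ with ∈-++⁻ (leaves n) t∈
    elenas-sound 1 t∈ | inj₁ (here refl) = leaf , refl
    ... | inj₂ t∈nonLeaf = map₁ spine⇒elena (nonLeaf-sound n t∈nonLeaf)

    nonLeaf-sound : ∀ n {t} → t ∈ nonLeaf n → Spine (children t) × size t ≡ n
    nonLeaf-sound n t∈ with ∈-++⁻ (unary n) t∈
    nonLeaf-sound (suc n) t∈ | inj₁ t∈unary with ∈-map⁻ wrap t∈unary
    ... | r , r∈ , refl = wrap-spine (elenas-sound n r∈)
    nonLeaf-sound n t∈ | inj₂ t∈branching = map₁ branching⇒spine (branching-sound n t∈branching)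

    branching-sound : ∀ n {t} → t ∈ branching n → Branching t × size t ≡ n
    branching-sound (suc n) t∈ with ∈-++⁻ (map addLeaf (nonLeaf n)) t∈
    ... | inj₁ t∈added with ∈-map⁻ addLeaf t∈added
    ...   | a , a∈ , refl = addLeaf-branching (nonLeaf-sound n a∈)
    branching-sound (suc n) t∈ | inj₂ t∈grown with ∈-map⁻ grow t∈grown
    ...   | b , b∈ , refl = grow-branching (branching-sound n b∈)

  mutual
    elenas-complete : ∀ n {t} → IsElena t → size t ≡ n → t ∈ elenas n
    elenas-complete n leaf        refl = here refl
    elenas-complete n (step ps e) sz   = ∈-++⁺ʳ (leaves n) (nonLeaf-complete n (spine ps e) sz)

    nonLeaf-complete : ∀ n {ts} → Spine ts → size (node ts) ≡ n → node ts ∈ nonLeaf n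
    nonLeaf-complete zero    (last e) ()
    nonLeaf-complete (suc n) (last {r} e) sz =
      ∈-++⁺ˡ (∈-map⁺ wrap (elenas-complete n e (ℕP.suc-injective (trans (sym (size-wrap r)) sz))))
    nonLeaf-complete n (path pp sp) sz = ∈-++⁺ʳ (unary n) (branching-complete n pp sp sz)

    branching-complete : ∀ n {p ts} → IsPath p → Spine ts → size (node (p ∷ ts)) ≡ n →
                         node (p ∷ ts) ∈ branching n
    branching-complete zero _ _ ()
    branching-complete (suc n) {ts = ts} end sp sz =
      ∈-++⁺ˡ (∈-map⁺ addLeaf (nonLeaf-complete n {ts} sp (ℕP.suc-injective sz)))
    branching-complete (suc n) {ts = ts} (cons {p} pp) sp sz = ∈-++⁺ʳ (map addLeaf (nonLeaf n))
      (∈-map⁺ grow (branching-complete n pp sp (ℕP.suc-injective (trans (sym (size-grow p ts)) sz))))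

  elenas-correct : ∀ n t → t ∈ elenas n ⇔ (IsElena t × size t ≡ n)
  elenas-correct n t = mk⇔ (elenas-sound n) (λ (e , sz) → elenas-complete n e sz)

  disjoint-by : ∀ {A : Set} {P Q : A → Set} {xs ys : List A} →
    (∀ {x} → x ∈ xs → P x) → (∀ {x} → x ∈ ys → Q x) → (∀ {x} → P x → ¬ Q x) → Disjoint xs ys
  disjoint-by inP inQ incompatible (x∈xs , x∈ys) = incompatible (inP x∈xs) (inQ x∈ys)

  leaves-leaf : ∀ n {t} → t ∈ leaves n → t ≡ leafTree
  leaves-leaf 1 (here refl) = refl

  unary-wrap : ∀ n {t} → t ∈ unary n → ∃[ r ] t ≡ wrap r
  unary-wrap (suc n) t∈ with ∈-map⁻ wrap t∈
  ... | r , _ , refl = r , refl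

  -- addLeaf makes the leftmost child a leaf, grow never does.
  addLeaf≢grow : ∀ a b → addLeaf a ≢ grow b
  addLeaf≢grow (node _) (node [])      ()
  addLeaf≢grow (node _) (node (_ ∷ _)) ()

  leaves-unique : ∀ n → Unique (leaves n)
  leaves-unique zero          = []
  leaves-unique 1             = [] ∷ []
  leaves-unique (suc (suc n)) = []

  wrap-injective : ∀ {s t} → wrap s ≡ wrap t → s ≡ t
  wrap-injective refl = refl

  addLeaf-injective : ∀ {s t} → addLeaf s ≡ addLeaf t → s ≡ t
  addLeaf-injective {node _} {node _} refl = refl

  grow-injective : ∀ {s t} → grow s ≡ grow t → s ≡ t
  grow-injective {node []}      {node []}      _    = refl
  grow-injective {node (_ ∷ _)} {node (_ ∷ _)} refl = refl

  -- No tree is listed twice: the constructions are injective and the parts of each list are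
  -- told apart by the shape of the root.
  mutual
    elenas-unique : ∀ n → Unique (elenas n)
    elenas-unique n = Unique.++⁺ (leaves-unique n) (nonLeaf-unique n)
      (disjoint-by (leaves-leaf n) (λ t∈ → proj₁ (nonLeaf-sound n t∈)) λ { refl () })

    nonLeaf-unique : ∀ n → Unique (nonLeaf n)
    nonLeaf-unique n = Unique.++⁺ (unary-unique n) (branching-unique n)
      (disjoint-by (unary-wrap n) (λ t∈ → proj₁ (branching-sound n t∈)) λ { (_ , refl) (_ , ()) })

    unary-unique : ∀ n → Unique (unary n)
    unary-unique zero    = []
    unary-unique (suc n) = Unique.map⁺ wrap-injective (elenas-unique n)

    branching-unique : ∀ n → Unique (branching n)
    branching-unique zero    = []
    branching-unique (suc n) = Unique.++⁺
      (Unique.map⁺ addLeaf-injective (nonLeaf-unique n)) (Unique.map⁺ grow-injective (branching-unique n))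
      (disjoint-by (∈-map⁻ addLeaf) (∈-map⁻ grow) λ { (a , _ , refl) (b , _ , eq) → addLeaf≢grow a b eq })

module Counting where

  open Enumeration
  open import Data.Nat as ℕ using (zero; suc; _+_; _*_; _≤_)
  import Data.Nat.Properties as ℕP
  open import Data.Nat.ListAction using (sum)
  open import Data.Nat.ListAction.Properties using (sum-++)
  open import Data.List using ([]; _∷_; _++_; map; length)
  import Data.List.Properties as List
  open import Data.List.Relation.Unary.Any using (here; there)
  open import Data.Product using (_,_; proj₁; proj₂)
  open import Relation.Binary.PropositionalEquality
  open import Data.Nat.Tactic.RingSolver using (solve-∀)

  sumOf : (PTree → ℕ) → List PTree → ℕ
  sumOf f xs = sum (map f xs)

  sumOf-++ : ∀ f xs ys → sumOf f (xs ++ ys) ≡ sumOf f xs + sumOf f ys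
  sumOf-++ f xs ys = trans (cong sum (List.map-++ f xs ys)) (sum-++ (map f xs) (map f ys))

  sumOf-map : ∀ {f g h} xs → (∀ {x} → x ∈ xs → f (g x) ≡ h x) → sumOf f (map g xs) ≡ sumOf h xs
  sumOf-map []       _  = refl
  sumOf-map (x ∷ xs) eq = cong₂ _+_ (eq (here refl)) (sumOf-map xs (λ x∈ → eq (there x∈)))

  sumOf-suc : ∀ f xs → sumOf (λ x → suc (f x)) xs ≡ length xs + sumOf f xs
  sumOf-suc f []       = refl
  sumOf-suc f (x ∷ xs) = cong suc (trans (cong (f x +_) (sumOf-suc f xs)) (swap (f x) (length xs) (sumOf f xs)))
    where
    swap : ∀ a b c → a + (b + c) ≡ b + (a + c)
    swap = solve-∀

  rightBranch-addLeaf : ∀ {t} → Spine (children t) → rightBranch (addLeaf t) ≡ rightBranch t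
  rightBranch-addLeaf {node (_ ∷ _)} _ = refl

  rightBranch-grow : ∀ {t} → Branching t → rightBranch (grow t) ≡ rightBranch t
  rightBranch-grow {node (_ ∷ _ ∷ _)} _ = refl
  rightBranch-grow {node (_ ∷ [])} (_ , ())

  length-unary : ∀ n → length (unary (suc n)) ≡ length (elenas n)
  length-unary n = List.length-map wrap (elenas n)

  length-branching : ∀ n → length (branching (suc n)) ≡ length (nonLeaf n) + length (branching n)
  length-branching n = trans (List.length-++ (map addLeaf (nonLeaf n)))
    (cong₂ _+_ (List.length-map addLeaf (nonLeaf n)) (List.length-map grow (branching n)))

  rightBranch-unary : ∀ n →
    sumOf rightBranch (unary (suc n)) ≡ length (elenas n) + sumOf rightBranch (elenas n)
  rightBranch-unary n = trans (sumOf-map (elenas n) (λ _ → refl)) (sumOf-suc rightBranch (elenas n))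

  rightBranch-branching : ∀ n →
    sumOf rightBranch (branching (suc n)) ≡ sumOf rightBranch (nonLeaf n) + sumOf rightBranch (branching n)
  rightBranch-branching n = trans (sumOf-++ rightBranch (map addLeaf (nonLeaf n)) (map grow (branching n)))
    (cong₂ _+_ (sumOf-map (nonLeaf n) (λ t∈ → rightBranch-addLeaf (proj₁ (nonLeaf-sound n t∈))))
               (sumOf-map (branching n) (λ t∈ → rightBranch-grow (proj₁ (branching-sound n t∈)))))

  -- Statistics of the Elenas of size m + 2 (where elenas = nonLeaf), split by whether the root
  -- has one child or more: u m and v m count them (they are the Fibonacci numbers F(2m-1) and
  -- F(2m)), r m is the total length of the rightmost branches of all of them and s m the part
  -- of that total coming from branching roots.
  u v r s : ℕ → ℕ
  u m = length (unary (2 + m))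
  v m = length (branching (2 + m))
  r m = sumOf rightBranch (elenas (2 + m))
  s m = sumOf rightBranch (branching (2 + m))

  count : ∀ m → length (elenas (2 + m)) ≡ u m + v m
  count m = List.length-++ (unary (2 + m))

  u-suc : ∀ m → u (suc m) ≡ u m + v m
  u-suc m = trans (length-unary (2 + m)) (count m)

  v-suc : ∀ m → v (suc m) ≡ u m + v m + v m
  v-suc m = trans (length-branching (2 + m)) (cong (_+ v m) (count m))

  r-suc : ∀ m → r (suc m) ≡ (u m + v m + r m) + (r m + s m)
  r-suc m = trans (sumOf-++ rightBranch (unary (3 + m)) (branching (3 + m)))
    (cong₂ _+_ (trans (rightBranch-unary (2 + m)) (cong (_+ r m) (count m))) (rightBranch-branching (2 + m)))

  s-suc : ∀ m → s (suc m) ≡ r m + s m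
  s-suc m = rightBranch-branching (2 + m)

  u-pos : ∀ m → 1 ≤ u m
  u-pos zero    = ℕP.≤-refl
  u-pos (suc m) = ℕP.≤-trans (u-pos m) (ℕP.≤-trans (ℕP.m≤m+n (u m) (v m)) (ℕP.≤-reflexive (sym (u-suc m))))

  count-bound : ∀ m → suc m ≤ u m + v m
  count-bound zero    = ℕP.≤-refl
  count-bound (suc m) = begin
    suc (suc m)                     ≤⟨ ℕP.+-mono-≤ (u-pos m) (count-bound m) ⟩
    u m + (u m + v m)               ≤⟨ ℕP.+-monoˡ-≤ (u m + v m) (ℕP.m≤m+n (u m) (v m)) ⟩
    (u m + v m) + (u m + v m)       ≤⟨ ℕP.+-monoʳ-≤ (u m + v m) (ℕP.m≤m+n (u m + v m) (v m)) ⟩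
    (u m + v m) + (u m + v m + v m) ≡⟨ cong₂ _+_ (u-suc m) (v-suc m) ⟨
    u (suc m) + v (suc m)           ∎
    where open ℕP.≤-Reasoning

  -- Cassini's identity F(2m)² + 1 = F(2m-1)·F(2m+1).
  cassini : ∀ m → v m * v m + 1 ≡ u m * u m + u m * v m
  cassini zero    = refl
  cassini (suc m) = begin
    v (suc m) * v (suc m) + 1                  ≡⟨ cong (λ y → y * y + 1) (v-suc m) ⟩
    (u m + v m + v m) * (u m + v m + v m) + 1  ≡⟨ expand (u m) (v m) ⟩
    (v m * v m + 1) + Δ                        ≡⟨ cong (_+ Δ) (cassini m) ⟩
    (u m * u m + u m * v m) + Δ                ≡⟨ collect (u m) (v m) ⟩
    (u m + v m) * (u m + v m) + (u m + v m) * (u m + v m + v m)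
      ≡⟨ cong₂ (λ x y → x * x + x * y) (u-suc m) (v-suc m) ⟨
    u (suc m) * u (suc m) + u (suc m) * v (suc m) ∎
    where
    open ≡-Reasoning
    Δ = u m * u m + 4 * u m * v m + 3 * v m * v m
    expand : ∀ u v → (u + v + v) * (u + v + v) + 1 ≡ (v * v + 1) + (u * u + 4 * u * v + 3 * v * v)
    expand = solve-∀
    collect : ∀ u v → (u * u + u * v) + (u * u + 4 * u * v + 3 * v * v)
                      ≡ (u + v) * (u + v) + (u + v) * (u + v + v)
    collect = solve-∀

  pell : ∀ m → (u m + 3 * v m) * (u m + 3 * v m) + 4 ≡ 5 * ((u m + v m) * (u m + v m))
  pell m = begin
    (u m + 3 * v m) * (u m + 3 * v m) + 4      ≡⟨ expand (u m) (v m) ⟩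
    Q + 4 * (v m * v m + 1)                    ≡⟨ cong (λ z → Q + 4 * z) (cassini m) ⟩
    Q + 4 * (u m * u m + u m * v m)            ≡⟨ collect (u m) (v m) ⟩
    5 * ((u m + v m) * (u m + v m))            ∎
    where
    open ≡-Reasoning
    Q = u m * u m + 6 * u m * v m + 5 * v m * v m
    expand : ∀ u v → (u + 3 * v) * (u + 3 * v) + 4 ≡ u * u + 6 * u * v + 5 * v * v + 4 * (v * v + 1)
    expand = solve-∀
    collect : ∀ u v → u * u + 6 * u * v + 5 * v * v + 4 * (u * u + u * v) ≡ 5 * ((u + v) * (u + v))
    collect = solve-∀

  branch-sums : ∀ m → 5 * r m ≡ (2 + m) * (2 * u m + v m) + 6 * u m + 10 * v m
                    × 5 * s m + m * u m ≡ (2 * m + 9) * v m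
  branch-sums zero    = refl , refl
  branch-sums (suc m) = r-step , s-step
    where
    open ≡-Reasoning
    r-eq = proj₁ (branch-sums m)
    s-eq = proj₂ (branch-sums m)

    s-step : 5 * s (suc m) + suc m * u (suc m) ≡ (2 * suc m + 9) * v (suc m)
    s-step = begin
      5 * s (suc m) + suc m * u (suc m)       ≡⟨ cong₂ (λ a b → 5 * a + suc m * b) (s-suc m) (u-suc m) ⟩
      5 * (r m + s m) + suc m * (u m + v m)   ≡⟨ regroup m (u m) (v m) (r m) (s m) ⟩
      5 * r m + (5 * s m + m * u m) + (m * v m + u m + v m)
        ≡⟨ cong₂ (λ a b → a + b + (m * v m + u m + v m)) r-eq s-eq ⟩
      ((2 + m) * (2 * u m + v m) + 6 * u m + 10 * v m) + (2 * m + 9) * v m + (m * v m + u m + v m)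
        ≡⟨ close m (u m) (v m) ⟩
      (2 * suc m + 9) * (u m + v m + v m)     ≡⟨ cong ((2 * suc m + 9) *_) (v-suc m) ⟨
      (2 * suc m + 9) * v (suc m)             ∎
      where
      regroup : ∀ m u v r s → 5 * (r + s) + suc m * (u + v) ≡ 5 * r + (5 * s + m * u) + (m * v + u + v)
      regroup = solve-∀
      close : ∀ m u v → ((2 + m) * (2 * u + v) + 6 * u + 10 * v) + (2 * m + 9) * v + (m * v + u + v)
                        ≡ (2 * suc m + 9) * (u + v + v)
      close = solve-∀

    -- the identity for r is obtained with m·u added to both sides, where the one for s applies
    r-step : 5 * r (suc m) ≡ (3 + m) * (2 * u (suc m) + v (suc m)) + 6 * u (suc m) + 10 * v (suc m)
    r-step = ℕP.+-cancelʳ-≡ (m * u m) _ _ (begin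
      5 * r (suc m) + m * u m                  ≡⟨ cong (λ a → 5 * a + m * u m) (r-suc m) ⟩
      5 * ((u m + v m + r m) + (r m + s m)) + m * u m ≡⟨ regroup m (u m) (v m) (r m) (s m) ⟩
      5 * (u m + v m) + 2 * (5 * r m) + (5 * s m + m * u m)
        ≡⟨ cong₂ (λ a b → 5 * (u m + v m) + 2 * a + b) r-eq s-eq ⟩
      5 * (u m + v m) + 2 * ((2 + m) * (2 * u m + v m) + 6 * u m + 10 * v m) + (2 * m + 9) * v m
        ≡⟨ close m (u m) (v m) ⟩
      (3 + m) * (2 * (u m + v m) + (u m + v m + v m)) + 6 * (u m + v m) + 10 * (u m + v m + v m) + m * u m
        ≡⟨ cong₂ (λ a b → (3 + m) * (2 * a + b) + 6 * a + 10 * b + m * u m) (u-suc m) (v-suc m) ⟨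
      (3 + m) * (2 * u (suc m) + v (suc m)) + 6 * u (suc m) + 10 * v (suc m) + m * u m ∎)
      where
      regroup : ∀ m u v r s → 5 * ((u + v + r) + (r + s)) + m * u ≡ 5 * (u + v) + 2 * (5 * r) + (5 * s + m * u)
      regroup = solve-∀
      close : ∀ m u v → 5 * (u + v) + 2 * ((2 + m) * (2 * u + v) + 6 * u + 10 * v) + (2 * m + 9) * v
                        ≡ (3 + m) * (2 * (u + v) + (u + v + v)) + 6 * (u + v) + 10 * (u + v + v) + m * u
      close = solve-∀

  -- The branch closed form in terms of x = u + v and h = u + 3v, with n = m + 2:
  -- 10r + nh = 5nx + (8x + 4h), i.e. 10r = n(5x - h) + 8x + 4h.
  branch-identity : ∀ m → 10 * r m + (2 + m) * (u m + 3 * v m)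
                         ≡ (2 + m) * (5 * (u m + v m)) + (8 * (u m + v m) + 4 * (u m + 3 * v m))
  branch-identity m = begin
    10 * r m + (2 + m) * (u m + 3 * v m)      ≡⟨ double (r m) ((2 + m) * (u m + 3 * v m)) ⟩
    2 * (5 * r m) + (2 + m) * (u m + 3 * v m)
      ≡⟨ cong (λ z → 2 * z + (2 + m) * (u m + 3 * v m)) (proj₁ (branch-sums m)) ⟩
    2 * ((2 + m) * (2 * u m + v m) + 6 * u m + 10 * v m) + (2 + m) * (u m + 3 * v m) ≡⟨ collect m (u m) (v m) ⟩
    (2 + m) * (5 * (u m + v m)) + (8 * (u m + v m) + 4 * (u m + 3 * v m)) ∎
    where
    open ≡-Reasoning
    double : ∀ r z → 10 * r + z ≡ 2 * (5 * r) + z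
    double = solve-∀
    collect : ∀ m u v → 2 * ((2 + m) * (2 * u + v) + 6 * u + 10 * v) + (2 + m) * (u + 3 * v)
                        ≡ (2 + m) * (5 * (u + v)) + (8 * (u + v) + 4 * (u + 3 * v))
    collect = solve-∀

  mutual
    rightBranch≤size : ∀ t → rightBranch t ≤ size t
    rightBranch≤size (node ts) = ℕ.s≤s (rightBranchL≤sizes ts)

    rightBranchL≤sizes : ∀ ts → rightBranchL ts ≤ sizes ts
    rightBranchL≤sizes []            = ℕ.z≤n
    rightBranchL≤sizes (t ∷ [])      = ℕP.≤-trans (rightBranch≤size t) (ℕP.m≤m+n (size t) 0)
    rightBranchL≤sizes (t ∷ t′ ∷ ts) =
      ℕP.≤-trans (rightBranchL≤sizes (t′ ∷ ts)) (ℕP.m≤n+m (sizes (t′ ∷ ts)) (size t))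

  branch+attached : ∀ {n} xs → (∀ {t} → t ∈ xs → size t ≡ n) →
    sumOf rightBranch xs + sumOf attachedNodes xs ≡ n * length xs
  branch+attached {n} []       _     = sym (ℕP.*-zeroʳ n)
  branch+attached {n} (x ∷ xs) sizes = begin
    (rightBranch x + sumOf rightBranch xs) + (attachedNodes x + sumOf attachedNodes xs)
      ≡⟨ interchange (rightBranch x) (sumOf rightBranch xs) (attachedNodes x) (sumOf attachedNodes xs) ⟩
    (rightBranch x + attachedNodes x) + (sumOf rightBranch xs + sumOf attachedNodes xs)
      ≡⟨ cong₂ _+_ (trans (ℕP.m+[n∸m]≡n (rightBranch≤size x)) (sizes (here refl)))
                   (branch+attached xs (λ t∈ → sizes (there t∈))) ⟩
    n + n * length xs   ≡⟨ ℕP.*-suc n (length xs) ⟨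
    n * suc (length xs) ∎
    where
    open ≡-Reasoning
    interchange : ∀ a b c d → (a + b) + (c + d) ≡ (a + c) + (b + d)
    interchange = solve-∀

module Rationals where

  open import Data.Nat as ℕ using (zero; suc)
  import Data.Nat.Properties as ℕP
  import Data.Nat.Coprimality as Coprime
  import Data.Integer as ℤ
  import Data.Integer.Properties as ℤP
  open import Data.Rational as ℚ using (ℚ; mkℚ; _+_; _*_; _-_; 0ℚ; 1ℚ; _<_; _≤_; toℚᵘ)
  import Data.Rational.Properties as ℚP
  open import Data.Rational.Unnormalised as ℚᵘ using (mkℚᵘ)
  import Data.Rational.Unnormalised.Properties as ℚᵘP
  open import Data.Product using (_,_; ∃-syntax)
  open import Data.Empty using (⊥-elim)
  open import Relation.Binary.PropositionalEquality
  open import Relation.Nullary using (yes; no)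
  open import Relation.Nullary.Decidable using (dec⇒maybe)
  import Tactic.RingSolver.Core.AlmostCommutativeRing as ACR
  open import Tactic.RingSolver using (solve-∀)

  ℚ-ring : ACR.AlmostCommutativeRing _ _
  ℚ-ring = ACR.fromCommutativeRing ℚP.+-*-commutativeRing (λ q → dec⇒maybe (0ℚ ℚP.≟ q))

  infix 8 ↑_
  ↑_ : ℕ → ℚ
  ↑_ = ℕtoℚ

  ↑-toℚᵘ : ∀ n → toℚᵘ (↑ n) ≡ mkℚᵘ (ℤ.+ n) 0
  ↑-toℚᵘ n = cong toℚᵘ (ℚP.normalize-coprime (Coprime.sym (Coprime.1-coprimeTo n)))

  ↑-suc : ∀ n → ↑ suc n ≡ 1ℚ + ↑ n
  ↑-suc n = ℚP.toℚᵘ-injective (begin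
    toℚᵘ (↑ suc n)                              ≡⟨ ↑-toℚᵘ (suc n) ⟩
    mkℚᵘ (ℤ.+ suc n) 0
      ≈⟨ ℚᵘ.*≡* (cong (ℤ._* ℤ.+ 1) (sym (cong (ℤ._+_ (ℤ.+ 1)) (ℤP.*-identityʳ (ℤ.+ n))))) ⟩
    mkℚᵘ (ℤ.+ 1) 0 ℚᵘ.+ mkℚᵘ (ℤ.+ n) 0          ≡⟨ cong (mkℚᵘ (ℤ.+ 1) 0 ℚᵘ.+_) (sym (↑-toℚᵘ n)) ⟩
    toℚᵘ 1ℚ ℚᵘ.+ toℚᵘ (↑ n)                     ≈⟨ ℚᵘP.≃-sym (ℚP.toℚᵘ-homo-+ 1ℚ (↑ n)) ⟩
    toℚᵘ (1ℚ + ↑ n)                             ∎)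
    where open ℚᵘP.≃-Reasoning

  ↑-+ : ∀ a b → ↑ (a ℕ.+ b) ≡ ↑ a + ↑ b
  ↑-+ zero    b = sym (ℚP.+-identityˡ (↑ b))
  ↑-+ (suc a) b = begin
    ↑ suc (a ℕ.+ b)     ≡⟨ ↑-suc (a ℕ.+ b) ⟩
    1ℚ + ↑ (a ℕ.+ b)    ≡⟨ cong (1ℚ +_) (↑-+ a b) ⟩
    1ℚ + (↑ a + ↑ b)    ≡⟨ ℚP.+-assoc 1ℚ (↑ a) (↑ b) ⟨
    (1ℚ + ↑ a) + ↑ b    ≡⟨ cong (_+ ↑ b) (↑-suc a) ⟨
    ↑ suc a + ↑ b       ∎
    where open ≡-Reasoning

  ↑-* : ∀ a b → ↑ (a ℕ.* b) ≡ ↑ a * ↑ b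
  ↑-* zero    b = sym (ℚP.*-zeroˡ (↑ b))
  ↑-* (suc a) b = begin
    ↑ (b ℕ.+ a ℕ.* b)   ≡⟨ ↑-+ b (a ℕ.* b) ⟩
    ↑ b + ↑ (a ℕ.* b)   ≡⟨ cong (↑ b +_) (↑-* a b) ⟩
    ↑ b + ↑ a * ↑ b     ≡⟨ distrib (↑ a) (↑ b) ⟩
    (1ℚ + ↑ a) * ↑ b    ≡⟨ cong (_* ↑ b) (↑-suc a) ⟨
    ↑ suc a * ↑ b       ∎
    where
    open ≡-Reasoning
    distrib : ∀ x y → y + x * y ≡ (1ℚ + x) * y
    distrib = solve-∀ ℚ-ring

  ↑-mono-≤ : ∀ {a b} → a ℕ.≤ b → ↑ a ≤ ↑ b
  ↑-mono-≤ {a} {b} a≤b = ℚP.toℚᵘ-cancel-≤ (subst₂ ℚᵘ._≤_ (sym (↑-toℚᵘ a)) (sym (↑-toℚᵘ b))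
    (ℚᵘ.*≤* (ℤP.*-monoʳ-≤-nonNeg (ℤ.+ 1) (ℤ.+≤+ a≤b))))

  ↑-mono-< : ∀ {a b} → a ℕ.< b → ↑ a < ↑ b
  ↑-mono-< {a} {b} a<b = ℚP.toℚᵘ-cancel-< (subst₂ ℚᵘ._<_ (sym (↑-toℚᵘ a)) (sym (↑-toℚᵘ b))
    (ℚᵘ.*<* (ℤP.*-monoʳ-<-pos (ℤ.+ 1) (ℤ.+<+ a<b))))

  ↑-nonNeg : ∀ n → 0ℚ ≤ ↑ n
  ↑-nonNeg n = ↑-mono-≤ {0} {n} ℕ.z≤n

  ↑-pos : ∀ n → 0ℚ < ↑ suc n
  ↑-pos n = ↑-mono-< {0} {suc n} (ℕ.s≤s ℕ.z≤n)

  archimedean : ∀ q → 0ℚ < q → ∃[ K ] 1ℚ ≤ ↑ K * q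
  archimedean (mkℚ (ℤ.+ zero) _ _) (ℚ.*<* (ℤ.+<+ ()))
  archimedean (mkℚ ℤ.-[1+ _ ] _ _) (ℚ.*<* ())
  archimedean q@(mkℚ ℤ.+[1+ k ] d _) _ =
    suc d , ℚP.toℚᵘ-cancel-≤ (ℚᵘP.≤-respʳ-≃ (ℚᵘP.≃-sym (ℚP.toℚᵘ-homo-* (↑ suc d) q)) unnormalised)
    where
    -- 1 ≤ (d+1)/1 · (k+1)/(d+1), i.e. d+1 ≤ (d+1)(k+1) after clearing denominators
    unnormalised : mkℚᵘ (ℤ.+ 1) 0 ℚᵘ.≤ toℚᵘ (↑ suc d) ℚᵘ.* toℚᵘ q
    unnormalised rewrite ↑-toℚᵘ (suc d) = ℚᵘ.*≤* (subst₂ ℤ._≤_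
      (sym (trans (ℤP.*-identityˡ _) (cong (λ z → ℤ.+ suc z) (ℕP.+-identityʳ d))))
      (sym (trans (ℤP.*-identityʳ _) (sym (ℤP.pos-* (suc d) (suc k)))))
      (ℤ.+≤+ (ℕP.m≤m*n (suc d) (suc k))))

  add-diff : ∀ p q → p + (q - p) ≡ q
  add-diff = solve-∀ ℚ-ring

  0<-⇒< : ∀ {p q} → 0ℚ < q - p → p < q
  0<-⇒< {p} {q} h = subst₂ _<_ (ℚP.+-identityʳ p) (add-diff p q) (ℚP.+-monoʳ-< p h)

  <⇒0<- : ∀ {p q} → p < q → 0ℚ < q - p
  <⇒0<- {p} {q} h = subst (_< q - p) (ℚP.+-inverseʳ p) (ℚP.+-monoˡ-< (ℚ.- p) h)

  0≤-⇒≤ : ∀ {p q} → 0ℚ ≤ q - p → p ≤ q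
  0≤-⇒≤ {p} {q} h = subst₂ _≤_ (ℚP.+-identityʳ p) (add-diff p q) (ℚP.+-monoʳ-≤ p h)

  ≤⇒0≤- : ∀ {p q} → p ≤ q → 0ℚ ≤ q - p
  ≤⇒0≤- {p} {q} h = subst (_≤ q - p) (ℚP.+-inverseʳ p) (ℚP.+-monoˡ-≤ (ℚ.- p) h)

  0≤-* : ∀ {p q} → 0ℚ ≤ p → 0ℚ ≤ q → 0ℚ ≤ p * q
  0≤-* {p} {q} hp hq =
    ℚP.nonNegative⁻¹ _ {{ℚP.nonNeg*nonNeg⇒nonNeg p {{ℚ.nonNegative hp}} q {{ℚ.nonNegative hq}}}}

  0<-* : ∀ {p q} → 0ℚ < p → 0ℚ < q → 0ℚ < p * q
  0<-* {p} {q} hp hq = ℚP.positive⁻¹ _ {{ℚP.pos*pos⇒pos p {{ℚ.positive hp}} q {{ℚ.positive hq}}}}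

  0<-cancel-* : ∀ {k q} → 0ℚ ≤ k → 0ℚ < k * q → 0ℚ < q
  0<-cancel-* {k} {q} k≥0 h =
    ℚP.*-cancelˡ-<-nonNeg k {{ℚ.nonNegative k≥0}} (subst (_< k * q) (sym (ℚP.*-zeroʳ k)) h)

  -- For p ≥ 0, comparing squares compares the numbers (this replaces square roots).
  square-cancel-< : ∀ {p q} → 0ℚ ≤ p → q * q < p * p → q < p
  square-cancel-< {p} {q} p≥0 q²<p² with q ℚP.<? p
  ... | yes q<p = q<p
  ... | no q≮p = ⊥-elim (ℚP.<-irrefl refl (ℚP.<-≤-trans q²<p² p²≤q²))
    where
    p≤q = ℚP.≮⇒≥ q≮p
    p²≤q² : p * p ≤ q * q
    p²≤q² = ℚP.≤-trans (ℚP.*-monoˡ-≤-nonNeg p {{ℚ.nonNegative p≥0}} p≤q)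
                       (ℚP.*-monoʳ-≤-nonNeg q {{ℚ.nonNegative (ℚP.≤-trans p≥0 p≤q)}} p≤q)

module Profiles where

  open Rationals
  import Data.Nat as ℕ
  import Data.Nat.Properties as ℕP
  open import Data.Rational as ℚ using (ℚ; _+_; _*_; _-_; 0ℚ; 1ℚ; _<_; _≤_)
  import Data.Rational.Properties as ℚP
  open import Data.Product using (_,_; ∃-syntax)
  open import Data.Sum using (_⊎_; inj₁; inj₂)
  open import Relation.Binary.PropositionalEquality
  open import Relation.Nullary using (yes; no)
  open import Tactic.RingSolver using (solve-∀)

  -- The relations satisfied by a size class of Elenas: n is the size, X the number of trees, R the
  -- total length of their rightmost branches and H an auxiliary quantity with H/X → √5.
  record Profile (n : ℕ) (X H R : ℚ) : Set where
    field
      one≤X  : 1ℚ ≤ X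
      n≤X+1  : ↑ n ≤ X + 1ℚ
      X≤H    : X ≤ H
      H≤3X   : H ≤ ↑ 3 * X
      pell   : H * H + ↑ 4 ≡ five * (X * X)
      branch : ten * R ≡ ↑ n * (five * X - H) + (↑ 8 * X + ↑ 4 * H)

  module _ {n X H R} (pr : Profile n X H R) where
    open Profile pr

    X>0 : 0ℚ < X
    X>0 = ℚP.<-≤-trans (↑-pos 0) one≤X

    X≥0 : 0ℚ ≤ X
    X≥0 = ℚP.<⇒≤ X>0

    H≥0 : 0ℚ ≤ H
    H≥0 = ℚP.≤-trans X≥0 X≤H

    constant>0 : 0ℚ < ↑ 8 * X + ↑ 4 * H
    constant>0 = ℚP.+-mono-<-≤ (0<-* (↑-pos 7) X>0) (0≤-* (↑-nonNeg 4) H≥0)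

    -- H < s·X whenever s > √5, because H² = 5X² - 4 < 5X².
    H<sX : ∀ {s} → 0ℚ ≤ s → five < s * s → H < s * X
    H<sX {s} s≥0 5<s² = square-cancel-< (0≤-* s≥0 X≥0) (begin-strict
      H * H               ≡⟨ ℚP.+-identityʳ (H * H) ⟨
      H * H + 0ℚ          <⟨ ℚP.+-monoʳ-< (H * H) (↑-pos 3) ⟩
      H * H + ↑ 4         ≡⟨ pell ⟩
      five * (X * X)      <⟨ ℚP.*-monoˡ-<-pos (X * X) {{ℚ.positive (0<-* X>0 X>0)}} 5<s² ⟩
      s * s * (X * X)     ≡⟨ regroup s X ⟩
      s * X * (s * X)     ∎)
      where
      open ℚP.≤-Reasoning
      regroup : ∀ s X → s * s * (X * X) ≡ s * X * (s * X)
      regroup = solve-∀ ℚ-ring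

    -- Lower half: a·n·X < R for every a < (5 - √5)/10, i.e. s = 5 - 10a > √5, since
    -- 10(R - anX) = n(sX - H) + (8X + 4H).
    branch-lower : ∀ {a} → BelowC₋ a → a * ↑ n * X < R
    branch-lower {a} (s≥0 , 5<s²) =
      0<-⇒< (0<-cancel-* (↑-nonNeg 10) (subst (0ℚ <_) (sym gap) gap>0))
      where
      open ≡-Reasoning
      s = five - ten * a
      C = ↑ 8 * X + ↑ 4 * H
      expand : ∀ R a N X → ten * (R - a * N * X) ≡ ten * R - ten * a * N * X
      expand = solve-∀ ℚ-ring
      collect : ∀ N X H a C → N * (five * X - H) + C - ten * a * N * X ≡ N * ((five - ten * a) * X - H) + C
      collect = solve-∀ ℚ-ring
      gap : ten * (R - a * ↑ n * X) ≡ ↑ n * (s * X - H) + C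
      gap = begin
        ten * (R - a * ↑ n * X)                      ≡⟨ expand R a (↑ n) X ⟩
        ten * R - ten * a * ↑ n * X                  ≡⟨ cong (_- ten * a * ↑ n * X) branch ⟩
        ↑ n * (five * X - H) + C - ten * a * ↑ n * X ≡⟨ collect (↑ n) X H a C ⟩
        ↑ n * (s * X - H) + C                        ∎
      gap>0 : 0ℚ < ↑ n * (s * X - H) + C
      gap>0 = ℚP.+-mono-≤-< (0≤-* (↑-nonNeg n) (ℚP.<⇒≤ (<⇒0<- (H<sX s≥0 5<s²)))) constant>0

    -- Upper half, reduced to the linear part n(H - tX) of the branch identity dominating its
    -- constant part, where t = 5 - 10b: indeed 10(bnX - R) = n(H - tX) - (8X + 4H).
    branch-upper : ∀ {b} → ↑ 8 * X + ↑ 4 * H < ↑ n * (H - (five - ten * b) * X) → R < b * ↑ n * X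
    branch-upper {b} dominates =
      0<-⇒< (0<-cancel-* (↑-nonNeg 10) (subst (0ℚ <_) (sym gap) (<⇒0<- dominates)))
      where
      open ≡-Reasoning
      C = ↑ 8 * X + ↑ 4 * H
      expand : ∀ R b N X → ten * (b * N * X - R) ≡ ten * b * N * X - ten * R
      expand = solve-∀ ℚ-ring
      collect : ∀ N X H b C → ten * b * N * X - (N * (five * X - H) + C) ≡ N * (H - (five - ten * b) * X) - C
      collect = solve-∀ ℚ-ring
      gap : ten * (b * ↑ n * X - R) ≡ ↑ n * (H - (five - ten * b) * X) - C
      gap = begin
        ten * (b * ↑ n * X - R)                        ≡⟨ expand R b (↑ n) X ⟩
        ten * b * ↑ n * X - ten * R                    ≡⟨ cong (ten * b * ↑ n * X -_) branch ⟩
        ten * b * ↑ n * X - (↑ n * (five * X - H) + C) ≡⟨ collect (↑ n) X H b C ⟩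
        ↑ n * (H - (five - ten * b) * X) - C           ∎

    constant-bound : ∀ {t} → 0ℚ ≤ t → t ≤ ↑ 3 → (↑ 8 * X + ↑ 4 * H) * (H + t * X) ≤ ↑ 120 * (X * X)
    constant-bound {t} t≥0 t≤3 = begin
      (↑ 8 * X + ↑ 4 * H) * (H + t * X) ≤⟨ ℚP.*-monoʳ-≤-nonNeg (H + t * X) {{ℚ.nonNegative P≥0}} C≤20X ⟩
      ↑ 20 * X * (H + t * X)
        ≤⟨ ℚP.*-monoˡ-≤-nonNeg (↑ 20 * X) {{ℚ.nonNegative (0≤-* (↑-nonNeg 20) X≥0)}} P≤6X ⟩
      ↑ 20 * X * (↑ 6 * X)              ≡⟨ regroup X ⟩
      ↑ 120 * (X * X)                   ∎
      where
      open ℚP.≤-Reasoning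
      3X-H≥0 : 0ℚ ≤ ↑ 3 * X - H
      3X-H≥0 = ≤⇒0≤- H≤3X
      P≥0 : 0ℚ ≤ H + t * X
      P≥0 = ℚP.+-mono-≤ H≥0 (0≤-* t≥0 X≥0)
      C≤20X : ↑ 8 * X + ↑ 4 * H ≤ ↑ 20 * X
      C≤20X = 0≤-⇒≤ (subst (0ℚ ≤_) (diff X H) (0≤-* (↑-nonNeg 4) 3X-H≥0))
        where
        diff : ∀ X H → ↑ 4 * (↑ 3 * X - H) ≡ ↑ 20 * X - (↑ 8 * X + ↑ 4 * H)
        diff = solve-∀ ℚ-ring
      P≤6X : H + t * X ≤ ↑ 6 * X
      P≤6X = 0≤-⇒≤ (subst (0ℚ ≤_) (diff X H t) (ℚP.+-mono-≤ 3X-H≥0 (0≤-* (≤⇒0≤- t≤3) X≥0)))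
        where
        diff : ∀ X H t → (↑ 3 * X - H) + (↑ 3 - t) * X ≡ ↑ 6 * X - (H + t * X)
        diff = solve-∀ ℚ-ring
      regroup : ∀ X → ↑ 20 * X * (↑ 6 * X) ≡ ↑ 120 * (X * X)
      regroup = solve-∀ ℚ-ring

    linear-factor : ∀ t → ↑ n * (H - t * X) * (H + t * X) ≡ ↑ n * (five - t * t) * (X * X) - ↑ 4 * ↑ n
    linear-factor t = begin
      ↑ n * (H - t * X) * (H + t * X)                               ≡⟨ expand (↑ n) H t X ⟩
      ↑ n * (H * H + ↑ 4) - ↑ n * (t * t * (X * X)) - ↑ 4 * ↑ n
        ≡⟨ cong (λ z → ↑ n * z - ↑ n * (t * t * (X * X)) - ↑ 4 * ↑ n) pell ⟩
      ↑ n * (five * (X * X)) - ↑ n * (t * t * (X * X)) - ↑ 4 * ↑ n  ≡⟨ collect (↑ n) t X ⟩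
      ↑ n * (five - t * t) * (X * X) - ↑ 4 * ↑ n                    ∎
      where
      open ≡-Reasoning
      expand : ∀ N H t X → N * (H - t * X) * (H + t * X) ≡ N * (H * H + ↑ 4) - N * (t * t * (X * X)) - ↑ 4 * N
      expand = solve-∀ ℚ-ring
      collect : ∀ N t X → N * (five * (X * X)) - N * (t * t * (X * X)) - ↑ 4 * N
                          ≡ N * (five - t * t) * (X * X) - ↑ 4 * N
      collect = solve-∀ ℚ-ring

    -- For c ≥ 130: 120X² < cX² - 4n, since X ≥ 1 and n ≤ X + 1; explicitly
    -- cX² - 4n - 120X² = (c - 130)X² + 4(X + 1 - n) + 4X(X - 1) + 6(X - 1)(X + 1) + 2.
    quadratic-gap : ∀ {c} → ↑ 130 ≤ c → ↑ 120 * (X * X) < c * (X * X) - ↑ 4 * ↑ n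
    quadratic-gap {c} 130≤c = 0<-⇒< (subst (0ℚ <_) (split c (↑ n) X)
      (ℚP.+-mono-≤-< (ℚP.+-mono-≤ (ℚP.+-mono-≤ (ℚP.+-mono-≤
        (0≤-* (≤⇒0≤- 130≤c) (0≤-* X≥0 X≥0))
        (0≤-* (↑-nonNeg 4) (≤⇒0≤- n≤X+1)))
        (0≤-* (0≤-* (↑-nonNeg 4) X≥0) X-1≥0))
        (0≤-* (0≤-* (↑-nonNeg 6) X-1≥0) (ℚP.+-mono-≤ X≥0 (↑-nonNeg 1))))
        (↑-pos 1)))
      where
      X-1≥0 : 0ℚ ≤ X - 1ℚ
      X-1≥0 = ≤⇒0≤- one≤X
      split : ∀ c N X → (c - ↑ 130) * (X * X) + ↑ 4 * (X + 1ℚ - N) + ↑ 4 * X * (X - 1ℚ)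
                        + ↑ 6 * (X - 1ℚ) * (X + 1ℚ) + ↑ 2
                      ≡ c * (X * X) - ↑ 4 * N - ↑ 120 * (X * X)
      split = solve-∀ ℚ-ring

  -- For 0 ≤ t < √5 the linear part n(H - tX) of the branch identity eventually dominates the
  -- constant part 8X + 4H: after multiplying by H + tX the left side is n((5 - t²)X² - 4),
  -- of order nX², while the right side is at most 120X².
  linear-dominates : ∀ {t} → 0ℚ ≤ t → t * t < five →
    ∃[ K ] ∀ {n X H R} → K ℕ.≤ n → Profile n X H R → ↑ 8 * X + ↑ 4 * H < ↑ n * (H - t * X)
  linear-dominates {t} t≥0 t²<5 with archimedean (five - t * t) (<⇒0<- t²<5)
  ... | K , 1≤Kη = 130 ℕ.* K , dominates
    where
    η = five - t * t

    t≤3 : t ≤ ↑ 3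
    t≤3 = ℚP.<⇒≤ (square-cancel-< (↑-nonNeg 3)
            (ℚP.<-trans t²<5 (↑-mono-< {5} {9} (ℕP.m<m+n 5 (ℕ.s≤s ℕ.z≤n)))))

    130≤nη : ∀ {n} → 130 ℕ.* K ℕ.≤ n → ↑ 130 ≤ ↑ n * η
    130≤nη {n} K≤n = begin
      ↑ 130               ≡⟨ ℚP.*-identityʳ (↑ 130) ⟨
      ↑ 130 * 1ℚ          ≤⟨ ℚP.*-monoˡ-≤-nonNeg (↑ 130) {{ℚ.nonNegative (↑-nonNeg 130)}} 1≤Kη ⟩
      ↑ 130 * (↑ K * η)   ≡⟨ ℚP.*-assoc (↑ 130) (↑ K) η ⟨
      ↑ 130 * ↑ K * η     ≡⟨ cong (_* η) (↑-* 130 K) ⟨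
      ↑ (130 ℕ.* K) * η
        ≤⟨ ℚP.*-monoʳ-≤-nonNeg η {{ℚ.nonNegative (ℚP.<⇒≤ (<⇒0<- t²<5))}} (↑-mono-≤ K≤n) ⟩
      ↑ n * η             ∎
      where open ℚP.≤-Reasoning

    dominates : ∀ {n X H R} → 130 ℕ.* K ℕ.≤ n → Profile n X H R → ↑ 8 * X + ↑ 4 * H < ↑ n * (H - t * X)
    dominates {n} {X} {H} {R} K≤n pr =
      ℚP.*-cancelʳ-<-nonNeg (H + t * X) {{ℚ.nonNegative (ℚP.+-mono-≤ (H≥0 pr) (0≤-* t≥0 (X≥0 pr)))}}
        (begin-strict
          (↑ 8 * X + ↑ 4 * H) * (H + t * X) ≤⟨ constant-bound pr t≥0 t≤3 ⟩
          ↑ 120 * (X * X)                   <⟨ quadratic-gap pr (130≤nη K≤n) ⟩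
          ↑ n * η * (X * X) - ↑ 4 * ↑ n      ≡⟨ linear-factor pr t ⟨
          ↑ n * (H - t * X) * (H + t * X)   ∎)
      where open ℚP.≤-Reasoning

  nonNeg-majorant : ∀ {t} → t < 0ℚ ⊎ t * t < five → ∃[ t₀ ] t ≤ t₀ × 0ℚ ≤ t₀ × t₀ * t₀ < five
  nonNeg-majorant {t} t<√5 with t ℚP.<? 0ℚ | t<√5
  ... | yes t<0 | _         = 0ℚ , ℚP.<⇒≤ t<0 , ℚP.≤-refl , ↑-pos 4
  ... | no _    | inj₁ t<0  = 0ℚ , ℚP.<⇒≤ t<0 , ℚP.≤-refl , ↑-pos 4
  ... | no t≮0  | inj₂ t²<5 = t , ℚP.≤-refl , ℚP.≮⇒≥ t≮0 , t²<5

  -- Upper half: eventually R < b·n·X, for every b > (5 - √5)/10, i.e. t = 5 - 10b < √5: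
  -- take t₀ ≥ t as above, so that n(H - tX) ≥ n(H - t₀X) > 8X + 4H.  (The witnesses are
  -- destructured by helpers with explicit types, as `with` on these rational terms is slow.)
  branch-upper-eventually : ∀ {b} → AboveC₋ b →
    ∃[ K ] ∀ {n X H R} → K ℕ.≤ n → Profile n X H R → R < b * ↑ n * X
  branch-upper-eventually {b} t<√5 = from-majorant (nonNeg-majorant t<√5)
    where
    t = five - ten * b
    from-majorant : ∃[ t₀ ] t ≤ t₀ × 0ℚ ≤ t₀ × t₀ * t₀ < five →
      ∃[ K ] ∀ {n X H R} → K ℕ.≤ n → Profile n X H R → R < b * ↑ n * X
    from-majorant (t₀ , t≤t₀ , t₀≥0 , t₀²<5) = from-dominance (linear-dominates t₀≥0 t₀²<5)
      where
      from-dominance :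
        ∃[ K ] (∀ {n X H R} → K ℕ.≤ n → Profile n X H R → ↑ 8 * X + ↑ 4 * H < ↑ n * (H - t₀ * X)) →
        ∃[ K ] ∀ {n X H R} → K ℕ.≤ n → Profile n X H R → R < b * ↑ n * X
      from-dominance (K , dominates) = K , upper
        where
        upper : ∀ {n X H R} → K ℕ.≤ n → Profile n X H R → R < b * ↑ n * X
        upper {n} {X} {H} K≤n pr = branch-upper pr {b} (ℚP.<-≤-trans (dominates K≤n pr) t₀-to-t)
          where
          t₀-to-t : ↑ n * (H - t₀ * X) ≤ ↑ n * (H - t * X)
          t₀-to-t = ℚP.*-monoˡ-≤-nonNeg (↑ n) {{ℚ.nonNegative (↑-nonNeg n)}}
            (ℚP.+-monoʳ-≤ H (ℚP.neg-antimono-≤ (ℚP.*-monoʳ-≤-nonNeg X {{ℚ.nonNegative (X≥0 pr)}} t≤t₀)))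

module Asymptotics where

  open Rationals
  open Profiles
  open Counting using (sumOf)
  open import Data.Nat as ℕ using (suc; _≥_)
  import Data.Nat.Properties as ℕP
  open import Data.List using (length)
  open import Data.Rational as ℚ using (ℚ; _+_; _*_; _-_; 0ℚ; 1ℚ; _<_; _≤_)
  open import Data.Product using (_,_; proj₁; proj₂; ∃-syntax)
  open import Data.Sum using (_⊎_)
  open import Relation.Binary.PropositionalEquality
  open import Tactic.RingSolver using (solve-∀)

  profiles⇒asymptotic : ∀ (L : ℕ → List PTree) f →
    (∀ m → ∃[ H ] Profile (2 ℕ.+ m) (↑ length (L (2 ℕ.+ m))) H (sumℚ f (L (2 ℕ.+ m)))) →
    AsymptoticTo BelowC₋ AboveC₋ L f
  profiles⇒asymptotic L f profile a b a∈ b∈ = 2 ℕ.+ K , bounds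
    where
    K = proj₁ (branch-upper-eventually {b} b∈)
    bounds : ∀ n → n ≥ 2 ℕ.+ K →
      (a * ↑ n * ↑ length (L n) < sumℚ f (L n)) × (sumℚ f (L n) < b * ↑ n * ↑ length (L n))
    bounds (suc (suc m)) (ℕ.s≤s (ℕ.s≤s K≤m)) =
      branch-lower pr {a} a∈ , proj₂ (branch-upper-eventually {b} b∈) (ℕP.m≤n⇒m≤o+n 2 K≤m) pr
      where pr = proj₂ (profile m)

  complement-bounds : ∀ {F G N ℓ a b} → F + G ≡ N * ℓ →
    (1ℚ - b) * N * ℓ < F × F < (1ℚ - a) * N * ℓ → a * N * ℓ < G × G < b * N * ℓ
  complement-bounds {F} {G} {N} {ℓ} {a} {b} F+G≡Nℓ (lower , upper) =
    0<-⇒< (subst (0ℚ <_) (sym G-gap) (<⇒0<- upper)) , 0<-⇒< (subst (0ℚ <_) (sym gap-G) (<⇒0<- lower))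
    where
    G≡ : G ≡ N * ℓ - F
    G≡ = trans (add-sub F G) (cong (_- F) F+G≡Nℓ)
      where
      add-sub : ∀ F G → G ≡ (F + G) - F
      add-sub = solve-∀ ℚ-ring
    G-gap : G - a * N * ℓ ≡ (1ℚ - a) * N * ℓ - F
    G-gap = trans (cong (_- a * N * ℓ) G≡) (regroup N ℓ F a)
      where
      regroup : ∀ N ℓ F a → N * ℓ - F - a * N * ℓ ≡ (1ℚ - a) * N * ℓ - F
      regroup = solve-∀ ℚ-ring
    gap-G : b * N * ℓ - G ≡ F - (1ℚ - b) * N * ℓ
    gap-G = trans (cong (b * N * ℓ -_) G≡) (regroup N ℓ F b)
      where
      regroup : ∀ N ℓ F b → b * N * ℓ - (N * ℓ - F) ≡ F - (1ℚ - b) * N * ℓ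
      regroup = solve-∀ ℚ-ring

  complement : ∀ (L : ℕ → List PTree) (f g : PTree → ℕ) {Below Above Below′ Above′ : ℚ → Set} →
    (∀ n → sumOf f (L n) ℕ.+ sumOf g (L n) ≡ n ℕ.* length (L n)) →
    (∀ {q} → Below′ q → Above (1ℚ - q)) → (∀ {q} → Above′ q → Below (1ℚ - q)) →
    AsymptoticTo Below Above L f → AsymptoticTo Below′ Above′ L g
  complement L f g total below′⇒ above′⇒ asymptotic a b a∈ b∈ =
    proj₁ eventually , λ n n≥N → complement-bounds {a = a} {b} (cast-total n) (proj₂ eventually n n≥N)
    where
    eventually = asymptotic (1ℚ - b) (1ℚ - a) (above′⇒ {b} b∈) (below′⇒ {a} a∈)
    cast-total : ∀ n → sumℚ f (L n) + sumℚ g (L n) ≡ ↑ n * ↑ length (L n)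
    cast-total n = trans (sym (↑-+ (sumOf f (L n)) (sumOf g (L n))))
                         (trans (cong ↑_ (total n)) (↑-* n (length (L n))))

  -- The reflection q ↦ 1 - q exchanges the constants (5 - √5)/10 and (5 + √5)/10.
  reflect : ∀ q → five - ten * (1ℚ - q) ≡ ten * q - five
  reflect = solve-∀ ℚ-ring

  BelowC₊⇒AboveC₋ : ∀ {q} → BelowC₊ q → AboveC₋ (1ℚ - q)
  BelowC₊⇒AboveC₋ {q} = subst (λ t → (t < 0ℚ) ⊎ (t * t < five)) (sym (reflect q))

  AboveC₊⇒BelowC₋ : ∀ {q} → AboveC₊ q → BelowC₋ (1ℚ - q)
  AboveC₊⇒BelowC₋ {q} = subst (λ t → (0ℚ ≤ t) × (five < t * t)) (sym (reflect q))

module ElenaProfiles where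

  open Rationals
  open Profiles
  open Enumeration
  open Counting
  import Data.Nat as ℕ
  import Data.Nat.Properties as ℕP
  import Data.Nat.Tactic.RingSolver as ℕ-Solver
  open import Data.List using (length)
  open import Data.List.Membership.Propositional.Properties.WithK using (unique∧set⇒bag)
  open import Data.List.Relation.Binary.BagAndSetEquality using (∼bag⇒↭)
  open import Data.List.Relation.Binary.Permutation.Propositional using (_↭_)
  open import Data.List.Relation.Binary.Permutation.Propositional.Properties using (map⁺; ↭-length)
  open import Data.Nat.ListAction.Properties using (sum-↭)
  open import Data.Rational using (_+_; _*_; _-_; _≤_)
  open import Data.Product using (_,_; proj₂; ∃-syntax)
  open import Function.Bundles using (Equivalence)
  import Function.Properties.Equivalence as ⇔
  open import Relation.Binary.PropositionalEquality
  open import Tactic.RingSolver using (solve-∀)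

  elena-profile : ∀ m → Profile (2 ℕ.+ m) (↑ (u m ℕ.+ v m)) (↑ (u m ℕ.+ 3 ℕ.* v m)) (↑ r m)
  elena-profile m = record
    { one≤X  = ↑-mono-≤ (ℕP.≤-trans (u-pos m) (ℕP.m≤m+n (u m) (v m)))
    ; n≤X+1  = subst (↑ n ≤_) (↑-+ x 1)
                 (↑-mono-≤ (ℕP.≤-trans (ℕ.s≤s (count-bound m)) (ℕP.≤-reflexive (ℕP.+-comm 1 x))))
    ; X≤H    = ↑-mono-≤ (ℕP.+-monoʳ-≤ (u m) (ℕP.m≤n*m (v m) 3))
    ; H≤3X   = subst (↑ h ≤_) (↑-* 3 x) (↑-mono-≤ h≤3x)
    ; pell   = cast-pell
    ; branch = cast-branch
    }
    where
    open ≡-Reasoning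
    x = u m ℕ.+ v m
    h = u m ℕ.+ 3 ℕ.* v m
    n = 2 ℕ.+ m
    h≤3x : h ℕ.≤ 3 ℕ.* x
    h≤3x = ℕP.≤-trans (ℕP.m≤m+n h (2 ℕ.* u m)) (ℕP.≤-reflexive (regroup (u m) (v m)))
      where
      regroup : ∀ u v → u ℕ.+ 3 ℕ.* v ℕ.+ 2 ℕ.* u ≡ 3 ℕ.* (u ℕ.+ v)
      regroup = ℕ-Solver.solve-∀
    cast-pell : ↑ h * ↑ h + ↑ 4 ≡ five * (↑ x * ↑ x)
    cast-pell = begin
      ↑ h * ↑ h + ↑ 4          ≡⟨ cong (_+ ↑ 4) (↑-* h h) ⟨
      ↑ (h ℕ.* h) + ↑ 4        ≡⟨ ↑-+ (h ℕ.* h) 4 ⟨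
      ↑ (h ℕ.* h ℕ.+ 4)        ≡⟨ cong ↑_ (pell m) ⟩
      ↑ (5 ℕ.* (x ℕ.* x))      ≡⟨ ↑-* 5 (x ℕ.* x) ⟩
      five * ↑ (x ℕ.* x)       ≡⟨ cong (five *_) (↑-* x x) ⟩
      five * (↑ x * ↑ x)       ∎
    cast-branch : ten * ↑ r m ≡ ↑ n * (five * ↑ x - ↑ h) + (↑ 8 * ↑ x + ↑ 4 * ↑ h)
    cast-branch = begin
      ten * ↑ r m                                              ≡⟨ add-sub (ten * ↑ r m) (↑ n * ↑ h) ⟩
      ten * ↑ r m + ↑ n * ↑ h - ↑ n * ↑ h                      ≡⟨ cong (_- ↑ n * ↑ h) cast ⟩
      ↑ n * (five * ↑ x) + (↑ 8 * ↑ x + ↑ 4 * ↑ h) - ↑ n * ↑ h ≡⟨ collect (↑ n) (↑ x) (↑ h) ⟩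
      ↑ n * (five * ↑ x - ↑ h) + (↑ 8 * ↑ x + ↑ 4 * ↑ h)       ∎
      where
      lhs : ↑ (10 ℕ.* r m ℕ.+ n ℕ.* h) ≡ ten * ↑ r m + ↑ n * ↑ h
      lhs = trans (↑-+ (10 ℕ.* r m) (n ℕ.* h)) (cong₂ _+_ (↑-* 10 (r m)) (↑-* n h))
      rhs : ↑ (n ℕ.* (5 ℕ.* x) ℕ.+ (8 ℕ.* x ℕ.+ 4 ℕ.* h)) ≡ ↑ n * (five * ↑ x) + (↑ 8 * ↑ x + ↑ 4 * ↑ h)
      rhs = trans (↑-+ (n ℕ.* (5 ℕ.* x)) (8 ℕ.* x ℕ.+ 4 ℕ.* h))
              (cong₂ _+_ (trans (↑-* n (5 ℕ.* x)) (cong (↑ n *_) (↑-* 5 x)))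
                         (trans (↑-+ (8 ℕ.* x) (4 ℕ.* h)) (cong₂ _+_ (↑-* 8 x) (↑-* 4 h))))
      cast : ten * ↑ r m + ↑ n * ↑ h ≡ ↑ n * (five * ↑ x) + (↑ 8 * ↑ x + ↑ 4 * ↑ h)
      cast = trans (sym lhs) (trans (cong ↑_ (branch-identity m)) rhs)
      add-sub : ∀ p q → p ≡ p + q - q
      add-sub = solve-∀ ℚ-ring
      collect : ∀ N X H → N * (five * X) + (↑ 8 * X + ↑ 4 * H) - N * H ≡ N * (five * X - H) + (↑ 8 * X + ↑ 4 * H)
      collect = solve-∀ ℚ-ring

  module _ (L : ℕ → List PTree)
           (members : ∀ n t → (t ∈ L n) ⇔ (IsElena t × size t ≡ n))
           (unique : ∀ n → Unique (L n)) where

    L↭elenas : ∀ n → L n ↭ elenas n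
    L↭elenas n = ∼bag⇒↭ (unique∧set⇒bag (unique n) (elenas-unique n)
                   (λ {t} → ⇔.trans (members n t) (⇔.sym (elenas-correct n t))))

    L-profile : ∀ m → ∃[ H ] Profile (2 ℕ.+ m) (↑ length (L (2 ℕ.+ m))) H (sumℚ rightBranch (L (2 ℕ.+ m)))
    L-profile m = ↑ (u m ℕ.+ 3 ℕ.* v m) ,
      subst₂ (λ X R → Profile (2 ℕ.+ m) X (↑ (u m ℕ.+ 3 ℕ.* v m)) R)
        (cong ↑_ (sym (trans (↭-length (L↭elenas (2 ℕ.+ m))) (count m))))
        (cong ↑_ (sym (sum-↭ (map⁺ rightBranch (L↭elenas (2 ℕ.+ m))))))
        (elena-profile m)

    L-total : ∀ n → sumOf rightBranch (L n) ℕ.+ sumOf attachedNodes (L n) ≡ n ℕ.* length (L n)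
    L-total n = branch+attached (L n) (λ {t} t∈ → proj₂ (Equivalence.to (members n t) t∈))

open Asymptotics
open ElenaProfiles

mainTheorem5 : (L : ℕ → List PTree)
    → (∀ n t → (t ∈ L n) ⇔ (IsElena t × size t ≡ n))
    → (∀ n → Unique (L n))
    → AsymptoticTo BelowC₋ AboveC₋ L rightBranch
      × AsymptoticTo BelowC₊ AboveC₊ L attachedNodes
mainTheorem5 L members unique = rightBranch-asymptotics , attached-asymptotics
  where
  rightBranch-asymptotics : AsymptoticTo BelowC₋ AboveC₋ L rightBranch
  rightBranch-asymptotics = profiles⇒asymptotic L rightBranch (L-profile L members unique)

  attached-asymptotics : AsymptoticTo BelowC₊ AboveC₊ L attachedNodes
  attached-asymptotics = complement L rightBranch attachedNodes (L-total L members unique)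
    (λ {q} → BelowC₊⇒AboveC₋ {q}) (λ {q} → AboveC₊⇒BelowC₋ {q}) rightBranch-asymptotics
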